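{- For every LTLf formula $\varphi$: if $\vdash\varphi$ then $\models\varphi$.
   Context: Fix a set $\mathrm{Var}$ of propositional variables. LTLf formulae are generated by $\varphi,\psi ::= v \mid \bot \mid \varphi\Rightarrow\psi \mid \mathsf{X}\varphi \mid \varphi\,\mathcal{W}\,\psi$ with $v\in\mathrm{Var}$. Abbreviations: $\neg\varphi := \varphi\Rightarrow\bot$; $\top:=\neg\bot$; $\varphi\vee\psi := \neg\varphi\Rightarrow\psi$; $\varphi\wedge\psi := \neg(\neg\varphi\vee\neg\psi)$; $\varphi\Leftrightarrow\psi := (\varphi\Rightarrow\psi)\wedge(\psi\Rightarrow\varphi)$; $\mathsf{end} := \neg\mathsf{X}\top$; $\bullet\varphi := \neg\mathsf{X}\neg\varphi$; $\Box\varphi := \varphi\,\mathcal{W}\,\bot$; $\Diamond\varphi := \neg\Box\neg\varphi$. Semantics: a Kripke structure is a finite nonempty sequence $K^n=(\eta_1,\dots,\eta_n)$, $n\ge 1$, of valuations $\eta_i:\mathrm{Var}\to\{\mathfrak t,\mathfrak f\}$. For $1\le i\le n$: $K^n_i(v)=\eta_i(v)$; $K^n_i(\bot)=\mathfrak f$; $K^n_i(\varphi\Rightarrow\psi)=\mathfrak t$ iff $K^n_i(\varphi)=\mathfrak f$ or $K^n_i(\psi)=\mathfrak t$; $K^n_i(\mathsf{X}\varphi)=K^n_{i+1}(\varphi)$ if $i<n$ and $\mathfrak f$ if $i=n$; $K^n_i(\varphi\,\mathcal W\,\psi)=\mathfrak t$ iff either $K^n_j(\varphi)=\mathfrak t$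 for all $i\le j\le n$, or there is $i\le k\le n$ with $K^n_k(\psi)=\mathfrak t$ and $K^n_j(\varphi)=\mathfrak t$ for all $i\le j<k$. $\models\varphi$ iff $K^n_i(\varphi)=\mathfrak t$ for every Kripke structure $K^n$ and every $1\le i\le n$. Proof system: $\vdash\varphi$ means $\varphi$ is derivable in the system closed under propositional reasoning (all instances of propositional tautologies; modus ponens) together with: (WkNextDistr) $\vdash\bullet(\varphi\Rightarrow\psi)\Leftrightarrow(\bullet\varphi\Rightarrow\bullet\psi)$; (EndNextContra) $\vdash\mathsf{end}\Rightarrow\neg\mathsf{X}\varphi$; (Finite) $\vdash\Diamond\mathsf{end}$; (WkUntilUnroll) $\vdash\varphi\,\mathcal W\,\psi\Leftrightarrow\psi\vee(\varphi\wedge\bullet(\varphi\,\mathcal W\,\psi))$; (WkNextStep) from $\vdash\varphi$ infer $\vdash\bullet\varphi$; (Induction) from $\vdash\varphi\Rightarrow\psi$ and $\vdash\varphi\Rightarrow\bullet\varphi$ infer $\vdash\varphi\Rightarrow\Box\psi$. -}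

module Defs where

open import Data.Bool using (Bool; true; false; _∧_; _∨_; not)
open import Data.Nat using (ℕ; zero; suc; _≤_; _<_; _∸_; _+_)
open import Data.Nat using (_<ᵇ_)
open import Data.List using (List; []; _∷_; upTo; map)
open import Data.Bool.ListAction using (all; any)
open import Relation.Binary.PropositionalEquality using (_≡_)

module _ (Var : Set) where

  data Formula : Set where
    var  : Var → Formula
    ⊥'   : Formula
    _⇒_  : Formula → Formula → Formula
    X    : Formula → Formula
    _W_  : Formula → Formula → Formula

  infixr 5 _⇒_

module _ {Var : Set} where

  ¬' : Formula Var → Formula Var
  ¬' φ = φ ⇒ ⊥'

  ⊤' : Formula Var
  ⊤' = ¬' ⊥'

  _∨'_ : Formula Var → Formula Var → Formula Var
  φ ∨' ψ = ¬' φ ⇒ ψ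

  _∧'_ : Formula Var → Formula Var → Formula Var
  φ ∧' ψ = ¬' (¬' φ ∨' ¬' ψ)

  _⇔_ : Formula Var → Formula Var → Formula Var
  φ ⇔ ψ = (φ ⇒ ψ) ∧' (ψ ⇒ φ)

  end : Formula Var
  end = ¬' (X ⊤')

  ● : Formula Var → Formula Var
  ● φ = ¬' (X (¬' φ))

  □ : Formula Var → Formula Var
  □ φ = φ W ⊥'

  ◇ : Formula Var → Formula Var
  ◇ φ = ¬' (□ (¬' φ))

-- A Kripke structure K^n = (η₁,…,ηₙ), n ≥ 1, is represented with n = suc m
-- by its length and a sequence of valuations η : ℕ → Var → Bool of which
-- only the entries η 1, …, η n (1-based) are ever consulted by the
-- semantics below; positions outside 1..n are irrelevant.
record Kripke (Var : Set) : Set where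
  constructor kripke
  field
    m : ℕ
    η : ℕ → Var → Bool

module _ {Var : Set} where

  len : Kripke Var → ℕ
  len K = suc (Kripke.m K)

  -- the list [a, a+1, …, b] (empty if b < a)
  range : ℕ → ℕ → List ℕ
  range a b = map (λ k → a + k) (upTo (suc b ∸ a))

  ⟦_⟧ : Formula Var → (K : Kripke Var) → ℕ → Bool
  ⟦ var v ⟧ K i = Kripke.η K i v
  ⟦ ⊥' ⟧ K i = false
  ⟦ φ ⇒ ψ ⟧ K i = not (⟦ φ ⟧ K i) ∨ ⟦ ψ ⟧ K i
  ⟦ X φ ⟧ K i with i <ᵇ len K
  ... | true  = ⟦ φ ⟧ K (suc i)
  ... | false = false
  ⟦ φ W ψ ⟧ K i =
      all (λ j → ⟦ φ ⟧ K j) (range i (len K))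
    ∨ any (λ k → ⟦ ψ ⟧ K k ∧ all (λ j → ⟦ φ ⟧ K j) (range i (k ∸ 1)))
          (range i (len K))

  ⊨_ : Formula Var → Set
  ⊨ φ = (K : Kripke Var) (i : ℕ) → 1 ≤ i → i ≤ len K → ⟦ φ ⟧ K i ≡ true

data PForm : Set where
  pvar : ℕ → PForm
  p⊥   : PForm
  _p⇒_ : PForm → PForm → PForm

evalP : (ℕ → Bool) → PForm → Bool
evalP ρ (pvar k) = ρ k
evalP ρ p⊥ = false
evalP ρ (A p⇒ B) = not (evalP ρ A) ∨ evalP ρ B

Tautology : PForm → Set
Tautology A = (ρ : ℕ → Bool) → evalP ρ A ≡ true

module _ {Var : Set} where

  inst : (ℕ → Formula Var) → PForm → Formula Var
  inst σ (pvar k) = σ k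
  inst σ p⊥ = ⊥'
  inst σ (A p⇒ B) = inst σ A ⇒ inst σ B

  data ⊢_ : Formula Var → Set where
    taut          : (A : PForm) → Tautology A → (σ : ℕ → Formula Var) → ⊢ inst σ A
    mp            : {φ ψ : Formula Var} → ⊢ (φ ⇒ ψ) → ⊢ φ → ⊢ ψ
    wkNextDistr   : (φ ψ : Formula Var) → ⊢ (● (φ ⇒ ψ) ⇔ (● φ ⇒ ● ψ))
    endNextContra : (φ : Formula Var) → ⊢ (end ⇒ ¬' (X φ))
    finite        : ⊢ ◇ end
    wkUntilUnroll : (φ ψ : Formula Var) → ⊢ ((φ W ψ) ⇔ (ψ ∨' (φ ∧' ● (φ W ψ))))
    wkNextStep    : {φ : Formula Var} → ⊢ φ → ⊢ ● φ
    induction     : {φ ψ : Formula Var} → ⊢ (φ ⇒ ψ) → ⊢ (φ ⇒ ● φ) → ⊢ (φ ⇒ □ ψ)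

{-# OPTIONS --safe #-}
module Submission where

-- Beyond Boolean bookkeeping, the content lies in
-- weak until: evaluated over the interval [i, n], it unfolds into its value at i + 1; at the
-- last state this refers to position n + 1, where the interval is empty and φ W ψ is true,
-- just as ● is vacuously true at the last state. Induction is sound because an invariant φ ⇒ ● φ carries φ, hence ψ, along
-- the whole interval [i, n]; Finite holds because end is true at the last state.

open import Defs
open import Algebra.Bundles using (CommutativeMonoid)
open import Data.Bool using (Bool; true; false; _∧_; _∨_; not)
open import Data.Bool.ListAction using (all; any; or)
open import Data.Bool.Properties
  using (∨-identityʳ; ∨-zeroʳ; not-involutive; ∧-identityʳ; ∧-commutativeMonoid; T-≡; ¬-not)
open import Data.List using (List; []; _∷_; map; upTo; applyUpTo)
open import Data.List.Membership.Propositional using (_∈_)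
open import Data.List.Membership.Propositional.Properties
  using (∈-map⁺; ∈-map⁻; ∈-upTo⁺; ∈-upTo⁻)
open import Data.List.Properties using (map-cong; map-cong-local; map-applyUpTo; map-upTo)
import Data.List.Relation.Unary.All as All
open import Data.List.Relation.Unary.All.Properties using (all⁺; all⁻)
open import Data.Nat using (ℕ; suc; _<ᵇ_; _+_; _∸_; _≤_; _<_; _≤′_; ≤′-refl; ≤′-step; s≤s; z≤n)
open import Data.Nat.Properties
  using (≤-refl; ≤-trans; <⇒≤; m≤m+n; +-suc; +-comm; +-identityʳ; +-∸-assoc;
         m≤n⇒m∸n≡0; m+[n∸m]≡n; ∸-monoˡ-<; m≤o∸n⇒m+n≤o; m∸n≢0⇒n<m; m<n⇒n≢0;
         m≤n⇒m<n∨m≡n; n<1+n; ≤⇒≤′; ≤′⇒≤; ∸-monoˡ-≤; ≤-pred; <⇒<ᵇ; <ᵇ⇒<; n≮n)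
open import Data.Product using (_×_; _,_; proj₁)
open import Data.Sum using (inj₁; inj₂)
open import Function using (_∘_; const; Equivalence)
open import Relation.Binary.PropositionalEquality
open ≡-Reasoning
open import Relation.Nullary using (contradiction)
open import Algebra.Properties.CommutativeSemigroup
  (CommutativeMonoid.commutativeSemigroup ∧-commutativeMonoid)
  using () renaming (x∙yz≈y∙xz to x∧yz≡y∧xz)

private
  variable
    A : Set
    i j : ℕ
    p f g : A → Bool
    xs : List A

any-const-false : (xs : List A) → any (const false) xs ≡ false
any-const-false [] = refl
any-const-false (_ ∷ xs) = any-const-false xs

any-∧ˡ : ∀ x (f : A → Bool) xs → any (λ k → x ∧ f k) xs ≡ x ∧ any f xs
any-∧ˡ true f xs = refl
any-∧ˡ false f xs = any-const-false xs

any-cong-local : (∀ {y} → y ∈ xs → f y ≡ g y) → any f xs ≡ any g xs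
any-cong-local f≡g = cong or (map-cong-local (All.tabulate f≡g))

all-true⁺ : (∀ {y} → y ∈ xs → p y ≡ true) → all p xs ≡ true
all-true⁺ {p = p} h = Equivalence.to T-≡ (all⁻ p (All.tabulate (Equivalence.from T-≡ ∘ h)))

all-true⁻ : all p xs ≡ true → {y : A} → y ∈ xs → p y ≡ true
all-true⁻ {p = p} {xs = xs} h y∈xs =
  Equivalence.to T-≡ (All.lookup (all⁺ p xs (Equivalence.from T-≡ h)) y∈xs)

all-false : {y : A} → y ∈ xs → p y ≡ false → all p xs ≡ false
all-false y∈xs py≡false =
  ¬-not (λ all≡true → true≢false (trans (sym (all-true⁻ all≡true y∈xs)) py≡false))
  where
  true≢false : true ≢ false
  true≢false ()

module _ {Var : Set} where

  range-∷ : ∀ {a b} → a ≤ b → range {Var} a b ≡ a ∷ range {Var} (suc a) b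
  range-∷ {a} {b} a≤b = begin
    map (a +_) (upTo (suc b ∸ a))              ≡⟨ cong (map (a +_) ∘ upTo) (+-∸-assoc 1 a≤b) ⟩
    a + 0 ∷ map (a +_) (applyUpTo suc (b ∸ a)) ≡⟨ cong₂ _∷_ (+-identityʳ a) tail ⟩
    a ∷ map (suc a +_) (upTo (b ∸ a))          ∎
    where
    tail : map (a +_) (applyUpTo suc (b ∸ a)) ≡ map (suc a +_) (upTo (b ∸ a))
    tail = begin
      map (a +_) (applyUpTo suc (b ∸ a))        ≡⟨ map-applyUpTo suc (a +_) (b ∸ a) ⟩
      applyUpTo (λ k → a + suc k) (b ∸ a)       ≡⟨ sym (map-upTo _ (b ∸ a)) ⟩
      map (λ k → a + suc k) (upTo (b ∸ a))      ≡⟨ map-cong (+-suc a) (upTo (b ∸ a)) ⟩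
      map (suc a +_) (upTo (b ∸ a))             ∎

  range-[] : ∀ {a b} → b < a → range {Var} a b ≡ []
  range-[] {a} {b} b<a = cong (map (a +_) ∘ upTo) (m≤n⇒m∸n≡0 b<a)

  ∈-range⁻ : ∀ {a b k} → k ∈ range {Var} a b → a ≤ k × k ≤ b
  ∈-range⁻ {a} {b} {k} k∈range with ∈-map⁻ (a +_) k∈range
  ... | j , j∈upTo , refl = m≤m+n a j , a+j≤b
    where
    j<c : j < suc b ∸ a
    j<c = ∈-upTo⁻ j∈upTo
    a+j≤b : a + j ≤ b
    a+j≤b = subst (_≤ b) (+-comm j a)
      (≤-pred (m≤o∸n⇒m+n≤o (suc j) (<⇒≤ (m∸n≢0⇒n<m (m<n⇒n≢0 j<c))) j<c))

  ∈-range⁺ : ∀ {a b k} → a ≤ k → k ≤ b → k ∈ range {Var} a b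
  ∈-range⁺ {a} {b} {k} a≤k k≤b =
    subst (_∈ range {Var} a b) (m+[n∸m]≡n a≤k)
      (∈-map⁺ (a +_) (∈-upTo⁺ (∸-monoˡ-< (s≤s k≤b) a≤k)))

  ⟦¬⟧ : ∀ (φ : Formula Var) K i → ⟦ ¬' φ ⟧ K i ≡ not (⟦ φ ⟧ K i)
  ⟦¬⟧ φ K i = ∨-identityʳ _

  ⟦∨⟧ : ∀ (φ ψ : Formula Var) K i → ⟦ φ ∨' ψ ⟧ K i ≡ ⟦ φ ⟧ K i ∨ ⟦ ψ ⟧ K i
  ⟦∨⟧ φ ψ K i with ⟦ φ ⟧ K i
  ... | true  = refl
  ... | false = refl

  ⟦∧⟧ : ∀ (φ ψ : Formula Var) K i → ⟦ φ ∧' ψ ⟧ K i ≡ ⟦ φ ⟧ K i ∧ ⟦ ψ ⟧ K i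
  ⟦∧⟧ φ ψ K i with ⟦ φ ⟧ K i | ⟦ ψ ⟧ K i
  ... | true  | true  = refl
  ... | true  | false = refl
  ... | false | _     = refl

  ⟦⇔⟧-true : ∀ (φ ψ : Formula Var) K i → ⟦ φ ⟧ K i ≡ ⟦ ψ ⟧ K i → ⟦ φ ⇔ ψ ⟧ K i ≡ true
  ⟦⇔⟧-true φ ψ K i φ≡ψ rewrite φ≡ψ with ⟦ ψ ⟧ K i
  ... | true  = refl
  ... | false = refl

  ⟦⇒⟧-mp : ∀ (φ ψ : Formula Var) K i → ⟦ φ ⇒ ψ ⟧ K i ≡ true → ⟦ φ ⟧ K i ≡ true → ⟦ ψ ⟧ K i ≡ true
  ⟦⇒⟧-mp φ ψ K i ⇒-true φ-true = subst (λ b → not b ∨ ⟦ ψ ⟧ K i ≡ true) φ-true ⇒-true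

  ⟦inst⟧ : ∀ (σ : ℕ → Formula Var) P K i → ⟦ inst σ P ⟧ K i ≡ evalP (λ k → ⟦ σ k ⟧ K i) P
  ⟦inst⟧ σ (pvar k) K i = refl
  ⟦inst⟧ σ p⊥       K i = refl
  ⟦inst⟧ σ (P p⇒ Q) K i = cong₂ (λ a b → not a ∨ b) (⟦inst⟧ σ P K i) (⟦inst⟧ σ Q K i)

  ⟦X⟧-< : ∀ (φ : Formula Var) K → i < len K → ⟦ X φ ⟧ K i ≡ ⟦ φ ⟧ K (suc i)
  ⟦X⟧-< {i} φ K i<n with i <ᵇ len K | <⇒<ᵇ i<n
  ... | true | _ = refl

  ⟦X⟧-last : ∀ (φ : Formula Var) K → ⟦ X φ ⟧ K (len K) ≡ false
  ⟦X⟧-last φ K with len K <ᵇ len K | <ᵇ⇒< (len K) (len K)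
  ... | false | _   = refl
  ... | true  | n<n = contradiction (n<n _) (n≮n (len K))

  ⟦●⟧-< : ∀ (φ : Formula Var) K → i < len K → ⟦ ● φ ⟧ K i ≡ ⟦ φ ⟧ K (suc i)
  ⟦●⟧-< {i} φ K i<n = begin
    ⟦ ● φ ⟧ K i                  ≡⟨ ⟦¬⟧ (X (¬' φ)) K i ⟩
    not (⟦ X (¬' φ) ⟧ K i)       ≡⟨ cong not (⟦X⟧-< (¬' φ) K i<n) ⟩
    not (⟦ ¬' φ ⟧ K (suc i))     ≡⟨ cong not (⟦¬⟧ φ K (suc i)) ⟩
    not (not (⟦ φ ⟧ K (suc i)))  ≡⟨ not-involutive _ ⟩
    ⟦ φ ⟧ K (suc i)              ∎

  ⟦●⟧-last : ∀ (φ : Formula Var) K → ⟦ ● φ ⟧ K (len K) ≡ true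
  ⟦●⟧-last φ K = trans (⟦¬⟧ (X (¬' φ)) K (len K)) (cong not (⟦X⟧-last (¬' φ) K))

  ⟦end⟧-< : ∀ K → i < len K → ⟦ end {Var} ⟧ K i ≡ false
  ⟦end⟧-< {i} K i<n = trans (⟦¬⟧ (X ⊤') K i) (cong not (⟦X⟧-< ⊤' K i<n))

  ⟦end⟧-last : ∀ K → ⟦ end {Var} ⟧ K (len K) ≡ true
  ⟦end⟧-last K = trans (⟦¬⟧ (X ⊤') K (len K)) (cong not (⟦X⟧-last ⊤' K))

  ⟦□⟧ : ∀ (φ : Formula Var) K i → ⟦ □ φ ⟧ K i ≡ all (λ j → ⟦ φ ⟧ K j) (range {Var} i (len K))
  ⟦□⟧ φ K i = trans (cong (all (λ j → ⟦ φ ⟧ K j) (range {Var} i (len K)) ∨_)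
                          (any-const-false (range {Var} i (len K))))
                    (∨-identityʳ _)

  ⟦W⟧-past-end : ∀ (φ ψ : Formula Var) K → ⟦ φ W ψ ⟧ K (suc (len K)) ≡ true
  ⟦W⟧-past-end φ ψ K rewrite range-[] {suc (len K)} {len K} (n<1+n (len K)) = refl

  ⟦W⟧-unfold : ∀ (φ ψ : Formula Var) K → 1 ≤ i → i ≤ len K →
               ⟦ φ W ψ ⟧ K i ≡ ⟦ ψ ⟧ K i ∨ (⟦ φ ⟧ K i ∧ ⟦ φ W ψ ⟧ K (suc i))
  ⟦W⟧-unfold {suc i} φ ψ K _ i≤n = begin
      all α (range {Var} (suc i) (len K)) ∨ any (witness (suc i)) (range {Var} (suc i) (len K))
    ≡⟨ cong (λ xs → all α xs ∨ any (witness (suc i)) xs) (range-∷ i≤n) ⟩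
      (α (suc i) ∧ all α rest) ∨ (witness (suc i) (suc i) ∨ any (witness (suc i)) rest)
    ≡⟨ cong₂ (λ u v → (α (suc i) ∧ all α rest) ∨ (u ∨ v)) now later ⟩
      (α (suc i) ∧ all α rest) ∨ (β (suc i) ∨ (α (suc i) ∧ any (witness (2 + i)) rest))
    ≡⟨ rearrange (α (suc i)) (β (suc i)) (all α rest) _ ⟩
      β (suc i) ∨ (α (suc i) ∧ (all α rest ∨ any (witness (2 + i)) rest))
    ∎
    where
    α β : ℕ → Bool
    α j = ⟦ φ ⟧ K j
    β j = ⟦ ψ ⟧ K j

    rest : List ℕ
    rest = range {Var} (2 + i) (len K)

    witness : ℕ → ℕ → Bool
    witness from k = β k ∧ all α (range {Var} from (k ∸ 1))

    now : witness (suc i) (suc i) ≡ β (suc i)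
    now = trans (cong (λ xs → β (suc i) ∧ all α xs) (range-[] (n<1+n i))) (∧-identityʳ (β (suc i)))

    step : ∀ {k} → k ∈ rest → witness (suc i) k ≡ α (suc i) ∧ witness (2 + i) k
    step {k} k∈rest =
      trans (cong (λ xs → β k ∧ all α xs) (range-∷ suc-i≤k-1)) (x∧yz≡y∧xz (β k) (α (suc i)) _)
      where
      suc-i≤k-1 : suc i ≤ k ∸ 1
      suc-i≤k-1 = ∸-monoˡ-≤ 1 (proj₁ (∈-range⁻ {2 + i} {len K} k∈rest))

    later : any (witness (suc i)) rest ≡ α (suc i) ∧ any (witness (2 + i)) rest
    later = trans (any-cong-local step) (any-∧ˡ (α (suc i)) (witness (2 + i)) rest)

    rearrange : ∀ a b x y → (a ∧ x) ∨ (b ∨ (a ∧ y)) ≡ b ∨ (a ∧ (x ∨ y))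
    rearrange true  true  x y = ∨-zeroʳ x
    rearrange true  false x y = refl
    rearrange false b     x y = refl

  ⟦●W⟧ : ∀ (φ ψ : Formula Var) K → i ≤ len K → ⟦ ● (φ W ψ) ⟧ K i ≡ ⟦ φ W ψ ⟧ K (suc i)
  ⟦●W⟧ φ ψ K i≤n with m≤n⇒m<n∨m≡n i≤n
  ... | inj₁ i<n  = ⟦●⟧-< (φ W ψ) K i<n
  ... | inj₂ refl = trans (⟦●⟧-last (φ W ψ) K) (sym (⟦W⟧-past-end φ ψ K))

  ⊨-taut : ∀ P → Tautology P → (σ : ℕ → Formula Var) → ⊨ inst σ P
  ⊨-taut P tautology σ K i _ _ = trans (⟦inst⟧ σ P K i) (tautology _)

  ⊨-mp : ∀ (φ ψ : Formula Var) → ⊨ (φ ⇒ ψ) → ⊨ φ → ⊨ ψ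
  ⊨-mp φ ψ ⊨φ⇒ψ ⊨φ K i 1≤i i≤n = ⟦⇒⟧-mp φ ψ K i (⊨φ⇒ψ K i 1≤i i≤n) (⊨φ K i 1≤i i≤n)

  ⊨-wkNextDistr : ∀ (φ ψ : Formula Var) → ⊨ (● (φ ⇒ ψ) ⇔ (● φ ⇒ ● ψ))
  ⊨-wkNextDistr φ ψ K i _ i≤n with m≤n⇒m<n∨m≡n i≤n
  ... | inj₁ i<n = ⟦⇔⟧-true (● (φ ⇒ ψ)) (● φ ⇒ ● ψ) K i
    (trans (⟦●⟧-< (φ ⇒ ψ) K i<n)
           (sym (cong₂ (λ a b → not a ∨ b) (⟦●⟧-< φ K i<n) (⟦●⟧-< ψ K i<n))))
  ... | inj₂ refl = ⟦⇔⟧-true (● (φ ⇒ ψ)) (● φ ⇒ ● ψ) K (len K)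
    (trans (⟦●⟧-last (φ ⇒ ψ) K)
           (sym (cong₂ (λ a b → not a ∨ b) (⟦●⟧-last φ K) (⟦●⟧-last ψ K))))

  ⊨-endNextContra : ∀ (φ : Formula Var) → ⊨ (end ⇒ ¬' (X φ))
  ⊨-endNextContra φ K i _ i≤n with m≤n⇒m<n∨m≡n i≤n
  ... | inj₁ i<n  rewrite ⟦end⟧-< K i<n = refl
  ... | inj₂ refl rewrite ⟦X⟧-last φ K  = ∨-zeroʳ _

  ⊨-finite : ⊨ ◇ (end {Var})
  ⊨-finite K i _ i≤n = begin
      ⟦ ◇ end ⟧ K i
    ≡⟨ ⟦¬⟧ (□ (¬' end)) K i ⟩
      not (⟦ □ (¬' end) ⟧ K i)
    ≡⟨ cong not (⟦□⟧ (¬' end) K i) ⟩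
      not (all (λ j → ⟦ ¬' end ⟧ K j) (range {Var} i (len K)))
    ≡⟨ cong not (all-false (∈-range⁺ i≤n ≤-refl) ¬end-fails) ⟩
      true
    ∎
    where
    ¬end-fails : ⟦ ¬' end ⟧ K (len K) ≡ false
    ¬end-fails = trans (⟦¬⟧ end K (len K)) (cong not (⟦end⟧-last K))

  ⊨-wkUntilUnroll : ∀ (φ ψ : Formula Var) → ⊨ ((φ W ψ) ⇔ (ψ ∨' (φ ∧' ● (φ W ψ))))
  ⊨-wkUntilUnroll φ ψ K i 1≤i i≤n = ⟦⇔⟧-true (φ W ψ) (ψ ∨' (φ ∧' ● (φ W ψ))) K i (begin
      ⟦ φ W ψ ⟧ K i
    ≡⟨ ⟦W⟧-unfold φ ψ K 1≤i i≤n ⟩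
      ⟦ ψ ⟧ K i ∨ (⟦ φ ⟧ K i ∧ ⟦ φ W ψ ⟧ K (suc i))
    ≡⟨ cong (λ b → ⟦ ψ ⟧ K i ∨ (⟦ φ ⟧ K i ∧ b)) (sym (⟦●W⟧ φ ψ K i≤n)) ⟩
      ⟦ ψ ⟧ K i ∨ (⟦ φ ⟧ K i ∧ ⟦ ● (φ W ψ) ⟧ K i)
    ≡⟨ cong (⟦ ψ ⟧ K i ∨_) (sym (⟦∧⟧ φ (● (φ W ψ)) K i)) ⟩
      ⟦ ψ ⟧ K i ∨ ⟦ φ ∧' ● (φ W ψ) ⟧ K i
    ≡⟨ sym (⟦∨⟧ ψ (φ ∧' ● (φ W ψ)) K i) ⟩
      ⟦ ψ ∨' (φ ∧' ● (φ W ψ)) ⟧ K i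
    ∎)

  ⊨-wkNextStep : ∀ (φ : Formula Var) → ⊨ φ → ⊨ ● φ
  ⊨-wkNextStep φ ⊨φ K i _ i≤n with m≤n⇒m<n∨m≡n i≤n
  ... | inj₁ i<n  = trans (⟦●⟧-< φ K i<n) (⊨φ K (suc i) (s≤s z≤n) i<n)
  ... | inj₂ refl = ⟦●⟧-last φ K

  ⊨-invariant-propagates : ∀ (φ : Formula Var) K → ⊨ (φ ⇒ ● φ) → 1 ≤ i →
                           ⟦ φ ⟧ K i ≡ true → i ≤′ j → j ≤ len K → ⟦ φ ⟧ K j ≡ true
  ⊨-invariant-propagates φ K ⊨inv 1≤i φ-true ≤′-refl _ = φ-true
  ⊨-invariant-propagates φ K ⊨inv 1≤i φ-true (≤′-step {j} i≤′j) j<n =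
    trans (sym (⟦●⟧-< φ K j<n))
          (⟦⇒⟧-mp φ (● φ) K j (⊨inv K j (≤-trans 1≤i (≤′⇒≤ i≤′j)) (<⇒≤ j<n))
                  (⊨-invariant-propagates φ K ⊨inv 1≤i φ-true i≤′j (<⇒≤ j<n)))

  ⊨-induction : ∀ (φ ψ : Formula Var) → ⊨ (φ ⇒ ψ) → ⊨ (φ ⇒ ● φ) → ⊨ (φ ⇒ □ ψ)
  ⊨-induction φ ψ ⊨φ⇒ψ ⊨inv K i 1≤i i≤n with ⟦ φ ⟧ K i in φ-true
  ... | false = refl
  ... | true  = trans (⟦□⟧ ψ K i) (all-true⁺ ψ-true)
    where
    ψ-true : ∀ {k} → k ∈ range {Var} i (len K) → ⟦ ψ ⟧ K k ≡ true
    ψ-true k∈range with i≤k , k≤n ← ∈-range⁻ {i} {len K} k∈range =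
      ⟦⇒⟧-mp φ ψ K _ (⊨φ⇒ψ K _ (≤-trans 1≤i i≤k) k≤n)
        (⊨-invariant-propagates φ K ⊨inv 1≤i φ-true (≤⇒≤′ i≤k) k≤n)

theorem4p2 : {Var : Set} (φ : Formula Var) → ⊢ φ → ⊨ φ
theorem4p2 _ (taut P tautology σ)          = ⊨-taut P tautology σ
theorem4p2 ψ (mp {φ} ⊢φ⇒ψ ⊢φ)              = ⊨-mp φ ψ (theorem4p2 (φ ⇒ ψ) ⊢φ⇒ψ) (theorem4p2 φ ⊢φ)
theorem4p2 _ (wkNextDistr φ ψ)             = ⊨-wkNextDistr φ ψ
theorem4p2 _ (endNextContra φ)             = ⊨-endNextContra φ
theorem4p2 _ finite                        = ⊨-finite
theorem4p2 _ (wkUntilUnroll φ ψ)           = ⊨-wkUntilUnroll φ ψ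
theorem4p2 _ (wkNextStep {φ} ⊢φ)           = ⊨-wkNextStep φ (theorem4p2 φ ⊢φ)
theorem4p2 _ (induction {φ} {ψ} ⊢φ⇒ψ ⊢inv) =
  ⊨-induction φ ψ (theorem4p2 (φ ⇒ ψ) ⊢φ⇒ψ) (theorem4p2 (φ ⇒ ● φ) ⊢inv)
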